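{- Let $p$ be a prime and let $k,\lambda$ be non-negative integers, and let $n$ be a positive integer, such that none of $n$, $k$, $k-\lambda$ is divisible by $p$. Let $\mathcal{F}=\{F_1, \ldots , F_n\}$ be a family of subsets of $[n]=\{1,\ldots,n\}$ such that $|F_i|\equiv k \pmod p$ for every $i$, and $|F_i\cap F_j|\equiv \lambda \pmod p$ for each $i\neq j$. Then $k(k-1)\equiv \lambda (n-1) \pmod p$. Moreover, for every $i\in [n]$, the degree $d_i$ of $i$ with respect to $\mathcal{F}$ satisfies $d_i\equiv k \pmod p$.
   Context: The degree $d_i$ of a point $i\in[n]$ with respect to $\mathcal{F}=\{F_1,\ldots,F_n\}$ is the number of indices $j\in[n]$ with $i\in F_j$. -}

module Defs where

open import Data.Nat using (ℕ)
open import Data.Integer using (ℤ; _-_; +_)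
open import Data.Integer.Divisibility using (_∣_)
open import Data.Fin using (Fin)
open import Data.Fin.Subset using (Subset; ∣_∣)
open import Data.Vec using (tabulate; lookup)

_≡_[modℤ_] : ℤ → ℤ → ℕ → Set
a ≡ b [modℤ m ] = (+ m) ∣ (a - b)

Family : ℕ → Set
Family n = Fin n → Subset n

degree : ∀ {n} → Family n → Fin n → ℕ
degree F i = ∣ tabulate (λ j → lookup (F j) i) ∣

-- Over 𝔽ₚ the incidence matrix A (A j i = 1 iff i ∈ F j) satisfies A Aᵀ = (k-λ) I + λ J
-- and A 𝟙 = k 𝟙, so B = k Aᵀ - λ J has A B = k (k-λ) I.  As k(k-λ) is invertible and 𝔽ₚⁿ is
-- finite, A is injective; since A (B 𝟙) = k(k-λ) 𝟙 = A ((k-λ) 𝟙) this gives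
-- k dᵢ - λ n = (B 𝟙)ᵢ = k - λ for every i.  Summing over i, with Σ dᵢ = Σ |F j| = n k, and
-- cancelling n yields k² - λ n = k - λ; hence k dᵢ = k², i.e. dᵢ = k.
module Submission where

open import Defs
open import Level using (_⊔_)
open import Data.Nat as ℕ using (ℕ; zero; suc; _^_; _≤_; NonZero)
import Data.Nat.Properties as ℕ
import Data.Nat.DivMod as ℕ
open import Data.Nat.Divisibility using (n∣m⇒m%n≡0) renaming (_∣_ to _∣ᴺ_)
open import Data.Nat.Primality using (Prime; euclidsLemma; prime⇒nonZero)
import Data.Integer.Properties as ℤ
open import Data.Integer.DivMod using (n%ℕd<d; a≡a%ℕn+[a/ℕn]*n)
open import Data.Integer.Divisibility.Signed as Signed using (divides)
open import Data.Integer.Tactic.RingSolver using (solve-∀)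
open import Data.Bool using (Bool; true; false; _∧_)
open import Data.Fin using (Fin; zero; suc; toℕ; fromℕ<; punchIn; punchOut; funToFin; finToFun; combine)
open import Data.Fin.Properties using (any?; _≟_; injective⇒≤; punchOut-injective; punchInᵢ≢i;
  funToFin-finToFin; finToFun-funToFin; toℕ-fromℕ<; toℕ<n; toℕ-injective)
open import Data.Fin.Subset using (Subset; ∣_∣; _∩_)
open import Data.Fin.Subset.Properties using (∩-idem)
open import Data.Vec using ([]; _∷_; lookup; tabulate)
open import Data.Vec.Properties using (lookup-zipWith; lookup∘tabulate)
open import Data.Vec.Functional using (Vector)
open import Data.Product using (∃; _×_; _,_)
open import Data.Sum using (inj₁; inj₂)
open import Data.Empty using (⊥-elim)
open import Function.Base using (_∘_)
open import Function.Bundles using (Bijection; module Surjection)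
open import Function.Definitions using (Injective; StrictlySurjective)
open import Function.Consequences using (strictlySurjective⇒surjective)
open import Algebra.Bundles using (CommutativeRing)
import Algebra.Definitions as AlgebraDefinitions
import Algebra.Properties.Semiring.Sum as Sum
open import Relation.Nullary using (¬_; yes; no; contradiction)
open import Relation.Binary.Bundles using (Setoid)
open import Relation.Binary.PropositionalEquality as ≡ using (_≡_; _≢_; _≗_; subst)
import Data.Vec.Functional.Relation.Binary.Equality.Setoid as VectorEquality
import Relation.Binary.Reasoning.Setoid as SetoidReasoning

injective⇒surjective : ∀ {m} (f : Fin m → Fin m) → Injective _≡_ _≡_ f →
                       StrictlySurjective _≡_ f
injective⇒surjective {suc m} f f-injective y with any? (λ x → f x ≟ y)
... | yes hit = hit
... | no miss = ⊥-elim (ℕ.1+n≰n (injective⇒≤ {f = f∖y} f∖y-injective))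
  where
  f∖y : Fin (suc m) → Fin m
  f∖y x = punchOut (miss ∘ (x ,_) ∘ ≡.sym)
  f∖y-injective : Injective _≡_ _≡_ f∖y
  f∖y-injective {x} {x′} =
    f-injective ∘ punchOut-injective (miss ∘ (x ,_) ∘ ≡.sym) (miss ∘ (x′ ,_) ∘ ≡.sym)

module FiniteSetoid {c ℓ} {S : Setoid c ℓ} {q : ℕ} (count : Bijection S (≡.setoid (Fin q))) where
  open Setoid S using (Carrier; _≈_)
  open Bijection count
  open Surjection surjection using (to∘to⁻)

  injective⇒strictlySurjective : (f : Carrier → Carrier) → Injective _≈_ _≈_ f →
                                 StrictlySurjective _≈_ f
  injective⇒strictlySurjective f f-injective y =
    let i , gi≡y = injective⇒surjective g g-injective (to y) in to⁻ i , injective gi≡y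
    where
    g : Fin q → Fin q
    g = to ∘ f ∘ to⁻
    g-injective : Injective _≡_ _≡_ g
    g-injective {i} {j} gi≡gj = begin
      i            ≡⟨ ≡.sym (to∘to⁻ i) ⟩
      to (to⁻ i)   ≡⟨ cong (f-injective (injective gi≡gj)) ⟩
      to (to⁻ j)   ≡⟨ to∘to⁻ j ⟩
      j            ∎
      where open ≡.≡-Reasoning

funToFin-cong : ∀ {m n} {f g : Fin m → Fin n} → f ≗ g → funToFin f ≡ funToFin g
funToFin-cong {zero}      f≗g = ≡.refl
funToFin-cong {suc m} {n} f≗g = ≡.cong₂ (combine {n = n ^ m}) (f≗g zero) (funToFin-cong (f≗g ∘ suc))

vectorBijection : ∀ {c ℓ} {S : Setoid c ℓ} {q} → Bijection S (≡.setoid (Fin q)) →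
                  ∀ n → Bijection (VectorEquality.≋-setoid S n) (≡.setoid (Fin (q ^ n)))
vectorBijection {S = S} {q} count n = record
  { to        = to′
  ; cong      = cong′
  ; bijective = injective′ , strictlySurjective⇒surjective ≡.trans cong′ surjective′
  }
  where
  open Bijection count
  open Surjection surjection using (to∘to⁻)
  open VectorEquality S using (_≋_)
  to′ : Vector (Setoid.Carrier S) n → Fin (q ^ n)
  to′ v = funToFin (to ∘ v)
  cong′ : ∀ {u v} → u ≋ v → to′ u ≡ to′ v
  cong′ u≋v = funToFin-cong (cong ∘ u≋v)
  injective′ : Injective _≋_ _≡_ to′
  injective′ {u} {v} eq i = injective (begin
    to (u i)                          ≡⟨ ≡.sym (finToFun-funToFin (to ∘ u) i) ⟩
    finToFun (funToFin (to ∘ u)) i    ≡⟨ ≡.cong (λ j → finToFun j i) eq ⟩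
    finToFun (funToFin (to ∘ v)) i    ≡⟨ finToFun-funToFin (to ∘ v) i ⟩
    to (v i)                          ∎)
    where open ≡.≡-Reasoning
  surjective′ : StrictlySurjective _≡_ to′
  surjective′ j = to⁻ ∘ finToFun j ,
    ≡.trans (funToFin-cong (to∘to⁻ ∘ finToFun {q} {n} j)) (funToFin-finToFin {n} {q} j)

module MatrixAlgebra {c ℓ} (R : CommutativeRing c ℓ) where

  open CommutativeRing R
  open Sum semiring
  open VectorEquality setoid using (_≋_; ≋-setoid; ≋-sym; ≋-trans)
  open SetoidReasoning setoid

  Matrix : ℕ → ℕ → Set c
  Matrix m n = Fin m → Fin n → Carrier

  infixr 7 _·_ _⊗_

  _·_ : ∀ {m n} → Matrix m n → Vector Carrier n → Vector Carrier m
  (A · x) i = ∑[ j < _ ] (A i j * x j)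

  _⊗_ : ∀ {m n o} → Matrix m n → Matrix n o → Matrix m o
  (A ⊗ B) i k = ∑[ j < _ ] (A i j * B j k)

  ·-cong : ∀ {m n} (A : Matrix m n) {x y} → x ≋ y → A · x ≋ A · y
  ·-cong A x≋y i = sum-cong-≋ (λ j → *-congˡ (x≋y j))

  ·-assoc : ∀ {m n o} (A : Matrix m n) (B : Matrix n o) x → A · (B · x) ≋ (A ⊗ B) · x
  ·-assoc {n = n} {o} A B x i = begin
    ∑[ j < n ] (A i j * ∑[ k < o ] (B j k * x k))
      ≈⟨ sum-cong-≋ (λ j → *-distribˡ-sum (A i j) (λ k → B j k * x k)) ⟩
    ∑[ j < n ] ∑[ k < o ] (A i j * (B j k * x k))
      ≈⟨ ∑-comm (λ j k → A i j * (B j k * x k)) ⟩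
    ∑[ k < o ] ∑[ j < n ] (A i j * (B j k * x k))
      ≈⟨ sum-cong-≋ (λ k → sum-cong-≋ (λ j → sym (*-assoc (A i j) (B j k) (x k)))) ⟩
    ∑[ k < o ] ∑[ j < n ] (A i j * B j k * x k)
      ≈⟨ sum-cong-≋ (λ k → sym (*-distribʳ-sum (x k) (λ j → A i j * B j k))) ⟩
    ∑[ k < o ] ((A ⊗ B) i k * x k)
      ∎

  sum-supportedAt : ∀ {n} (t : Vector Carrier n) i → (∀ {j} → j ≢ i → t j ≈ 0#) → sum t ≈ t i
  sum-supportedAt {suc n} t i vanishes = begin
    sum t                             ≈⟨ sum-remove t ⟩
    t i + ∑[ k < n ] t (punchIn i k)  ≈⟨ +-congˡ (sum-cong-≋ (λ k → vanishes (punchInᵢ≢i i k))) ⟩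
    t i + ∑[ k < n ] 0#               ≈⟨ +-congˡ (sum-replicate-zero n) ⟩
    t i + 0#                          ≈⟨ +-identityʳ (t i) ⟩
    t i                               ∎

  record IsScalarMatrix {n} (a : Carrier) (M : Matrix n n) : Set (c ⊔ ℓ) where
    field
      diagonal    : ∀ i → M i i ≈ a
      offDiagonal : ∀ {i j} → i ≢ j → M i j ≈ 0#

    ·-scalar : ∀ x → M · x ≋ (λ i → a * x i)
    ·-scalar x i = begin
      (M · x) i    ≈⟨ sum-supportedAt _ i (λ j≢i → trans (*-congʳ (offDiagonal (j≢i ∘ ≡.sym))) (zeroˡ _)) ⟩
      M i i * x i  ≈⟨ *-congʳ (diagonal i) ⟩
      a * x i      ∎

  module _ {n q} (finite : Bijection (≋-setoid n) (≡.setoid (Fin q)))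
           {A B : Matrix n n} {a} (a-cancel : ∀ {u v} → a * u ≈ a * v → u ≈ v)
           (AB-scalar : IsScalarMatrix a (A ⊗ B)) where

    private
      ABz≋az : ∀ z → A · (B · z) ≋ (λ i → a * z i)
      ABz≋az z i = trans (·-assoc A B z i) (IsScalarMatrix.·-scalar AB-scalar z i)

      cancel : ∀ {z z′} → A · (B · z) ≋ A · (B · z′) → z ≋ z′
      cancel {z} {z′} eq i = a-cancel (trans (sym (ABz≋az z i)) (trans (eq i) (ABz≋az z′ i)))

      preimage : ∀ x → ∃ λ z → B · z ≋ x
      preimage = FiniteSetoid.injective⇒strictlySurjective finite (B ·_) (cancel ∘ ·-cong A)

    -- B ·_ is injective since A B is a cancellable scalar, hence onto by finiteness; so every
    -- vector is some B z, on which A acts as the injective map z ↦ a z.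
    ·-injective : Injective _≋_ _≋_ (A ·_)
    ·-injective {x} {y} Ax≋Ay with x′ , Bx′≋x ← preimage x | y′ , By′≋y ← preimage y =
      ≋-trans (≋-sym Bx′≋x) (≋-trans (·-cong B x′≋y′) By′≋y)
      where
      x′≋y′ : x′ ≋ y′
      x′≋y′ = cancel (≋-trans (·-cong A Bx′≋x) (≋-trans Ax≋Ay (≋-sym (·-cong A By′≋y))))

open import Data.Integer using (ℤ; +_; _+_; _-_; _*_; -_; 0ℤ; 1ℤ; _%ℕ_; _/ℕ_) renaming (∣_∣ to ∣_∣ℤ)

module Modulo (p : ℕ) where

  -- A record rather than a synonym, so that a and b can be inferred from a ≈ b.
  infix 4 _≈_
  record _≈_ (a b : ℤ) : Set where
    constructor mod
    field divides-difference : + p Signed.∣ a - b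
  open _≈_ public

  ≈⇒≡[modℤ] : ∀ {a b} → a ≈ b → a ≡ b [modℤ p ]
  ≈⇒≡[modℤ] = Signed.∣⇒∣ᵤ ∘ divides-difference

  ≡[modℤ]⇒≈ : ∀ {a b} → a ≡ b [modℤ p ] → a ≈ b
  ≡[modℤ]⇒≈ = mod ∘ Signed.∣ᵤ⇒∣

  private
    p∣_ : ℤ → Set
    p∣ x = + p Signed.∣ x

    respect : ∀ {x y} → x ≡ y → p∣ x → p∣ y
    respect = subst p∣_

    ≡⇒≈ : ∀ {a b} → a ≡ b → a ≈ b
    ≡⇒≈ {a} ≡.refl = mod (divides 0ℤ (ℤ.+-inverseʳ a))

    ≈-sym : ∀ {a b} → a ≈ b → b ≈ a
    ≈-sym {a} {b} (mod p∣a-b) = mod (respect (swap a b) (Signed.∣m⇒∣-m p∣a-b))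
      where
      swap : ∀ a b → - (a - b) ≡ b - a
      swap = solve-∀

    ≈-trans : ∀ {a b c} → a ≈ b → b ≈ c → a ≈ c
    ≈-trans {a} {b} {c} (mod p∣a-b) (mod p∣b-c) =
      mod (respect (ℤ.+-minus-telescope a b c) (Signed.∣m∣n⇒∣m+n p∣a-b p∣b-c))

    +-cong : ∀ {a b c d} → a ≈ b → c ≈ d → a + c ≈ b + d
    +-cong {a} {b} {c} {d} (mod p∣a-b) (mod p∣c-d) =
      mod (respect (interchange a b c d) (Signed.∣m∣n⇒∣m+n p∣a-b p∣c-d))
      where
      interchange : ∀ a b c d → (a - b) + (c - d) ≡ (a + c) - (b + d)
      interchange = solve-∀

    *-cong : ∀ {a b c d} → a ≈ b → c ≈ d → a * c ≈ b * d
    *-cong {a} {b} {c} {d} (mod p∣a-b) (mod p∣c-d) =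
      mod (respect (split a b c d) (Signed.∣m∣n⇒∣m+n (Signed.∣m⇒∣m*n c p∣a-b) (Signed.∣n⇒∣m*n b p∣c-d)))
      where
      split : ∀ a b c d → (a - b) * c + b * (c - d) ≡ a * c - b * d
      split = solve-∀

    -‿cong : ∀ {a b} → a ≈ b → - a ≈ - b
    -‿cong {a} {b} (mod p∣a-b) = mod (respect (negate a b) (Signed.∣m⇒∣-m p∣a-b))
      where
      negate : ∀ a b → - (a - b) ≡ - a - - b
      negate = solve-∀

    factor : ∀ c a b → c * a - c * b ≡ c * (a - b)
    factor = solve-∀

  ℤ/pℤ : CommutativeRing _ _
  ℤ/pℤ = record
    { Carrier = ℤ
    ; _≈_ = _≈_
    ; _+_ = _+_
    ; _*_ = _*_
    ; -_ = -_
    ; 0# = 0ℤ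
    ; 1# = 1ℤ
    ; isCommutativeRing = record
      { isRing = record
        { +-isAbelianGroup = record
          { isGroup = record
            { isMonoid = record
              { isSemigroup = record
                { isMagma = record
                  { isEquivalence = record { refl = ≡⇒≈ ≡.refl ; sym = ≈-sym ; trans = ≈-trans }
                  ; ∙-cong = +-cong
                  }
                ; assoc = λ a b c → ≡⇒≈ (ℤ.+-assoc a b c)
                }
              ; identity = (λ a → ≡⇒≈ (ℤ.+-identityˡ a)) , (λ a → ≡⇒≈ (ℤ.+-identityʳ a))
              }
            ; inverse = (λ a → ≡⇒≈ (ℤ.+-inverseˡ a)) , (λ a → ≡⇒≈ (ℤ.+-inverseʳ a))
            ; ⁻¹-cong = -‿cong
            }
          ; comm = λ a b → ≡⇒≈ (ℤ.+-comm a b)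
          }
        ; *-cong = *-cong
        ; *-assoc = λ a b c → ≡⇒≈ (ℤ.*-assoc a b c)
        ; *-identity = (λ a → ≡⇒≈ (ℤ.*-identityˡ a)) , (λ a → ≡⇒≈ (ℤ.*-identityʳ a))
        ; distrib = (λ a b c → ≡⇒≈ (ℤ.*-distribˡ-+ a b c)) , (λ a b c → ≡⇒≈ (ℤ.*-distribʳ-+ a b c))
        }
      ; *-comm = λ a b → ≡⇒≈ (ℤ.*-comm a b)
      }
    }

  open AlgebraDefinitions _≈_ using (AlmostLeftCancellative)

  *-almostCancelˡ : Prime p → AlmostLeftCancellative 0ℤ _*_
  *-almostCancelˡ p-prime c a b c≉0 (mod p∣ca-cb)
    with euclidsLemma ∣ c ∣ℤ ∣ a - b ∣ℤ p-prime
           (subst (p ∣ᴺ_) (ℤ.abs-* c (a - b)) (Signed.∣⇒∣ᵤ (respect (factor c a b) p∣ca-cb)))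
  ... | inj₁ p∣c   = contradiction (mod (respect (≡.sym (ℤ.+-identityʳ c)) (Signed.∣ᵤ⇒∣ p∣c))) c≉0
  ... | inj₂ p∣a-b = mod (Signed.∣ᵤ⇒∣ p∣a-b)

  module _ {{_ : NonZero p}} where

    residue : ℤ → Fin p
    residue x = fromℕ< (n%ℕd<d x p)

    ≈-residue : ∀ x → x ≈ + toℕ (residue x)
    ≈-residue x = mod (divides (x /ℕ p) (begin
      x - + toℕ (residue x)                      ≡⟨ ≡.cong (λ r → x - + r) (toℕ-fromℕ< (n%ℕd<d x p)) ⟩
      x - + (x %ℕ p)                             ≡⟨ ≡.cong (_- + (x %ℕ p)) (a≡a%ℕn+[a/ℕn]*n x p) ⟩
      + (x %ℕ p) + (x /ℕ p) * + p - + (x %ℕ p)   ≡⟨ cancel (+ (x %ℕ p)) ((x /ℕ p) * + p) ⟩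
      (x /ℕ p) * + p                             ∎))
      where
      open ≡.≡-Reasoning
      cancel : ∀ r m → r + m - r ≡ m
      cancel = solve-∀

    residue-unique : ∀ {r s} → r ℕ.< p → s ℕ.< p → + r ≈ + s → r ≡ s
    residue-unique {r} {s} r<p s<p (mod p∣r-s) =
      ℤ.+-injective (ℤ.i-j≡0⇒i≡j (+ r) (+ s) (ℤ.∣i∣≡0⇒i≡0 (begin
        ∣ + r - + s ∣ℤ           ≡⟨ ℕ.m<n⇒m%n≡m ∣r-s∣<p ⟨
        ∣ + r - + s ∣ℤ ℕ.% p     ≡⟨ n∣m⇒m%n≡0 _ p (Signed.∣⇒∣ᵤ p∣r-s) ⟩
        0                       ∎)))
      where
      open ≡.≡-Reasoning
      ∣r-s∣<p : ∣ + r - + s ∣ℤ ℕ.< p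
      ∣r-s∣<p = ℕ.≤-<-trans
        (subst (ℕ._≤ r ℕ.⊔ s) (≡.cong ∣_∣ℤ (≡.sym (ℤ.[+m]-[+n]≡m⊖n r s))) (ℤ.∣m⊝n∣≤m⊔n r s))
        (ℕ.⊔-lub r<p s<p)

    residues : Bijection (CommutativeRing.setoid ℤ/pℤ) (≡.setoid (Fin p))
    residues = record
      { to        = residue
      ; cong      = residue-cong
      ; bijective = residue-injective , strictlySurjective⇒surjective ≡.trans residue-cong residue-surjective
      }
      where
      residue-cong : ∀ {x y} → x ≈ y → residue x ≡ residue y
      residue-cong {x} {y} x≈y = toℕ-injective (residue-unique (toℕ<n (residue x)) (toℕ<n (residue y))
        (≈-trans (≈-sym (≈-residue x)) (≈-trans x≈y (≈-residue y))))
      residue-injective : ∀ {x y} → residue x ≡ residue y → x ≈ y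
      residue-injective {x} {y} eq =
        ≈-trans (≈-residue x) (≈-trans (≡⇒≈ (≡.cong (+_ ∘ toℕ) eq)) (≈-sym (≈-residue y)))
      residue-surjective : StrictlySurjective _≡_ residue
      residue-surjective i = + toℕ i , toℕ-injective (≡.trans (toℕ-fromℕ< _) (ℕ.m<n⇒m%n≡m (toℕ<n i)))
module Counting where
  open Sum ℤ.+-*-semiring using (sum-syntax; sum-cong-≗)

  indicator : Bool → ℤ
  indicator true  = 1ℤ
  indicator false = 0ℤ

  ∣p∣≡∑indicator : ∀ {n} (s : Subset n) → + ∣ s ∣ ≡ ∑[ i < n ] indicator (lookup s i)
  ∣p∣≡∑indicator []          = ≡.refl
  ∣p∣≡∑indicator (true ∷ s)  = ≡.cong (λ m → 1ℤ + m) (∣p∣≡∑indicator s)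
  ∣p∣≡∑indicator (false ∷ s) = ≡.trans (∣p∣≡∑indicator s) (≡.sym (ℤ.+-identityˡ _))

  indicator-∧ : ∀ a b → indicator (a ∧ b) ≡ indicator a * indicator b
  indicator-∧ true  b = ≡.sym (ℤ.*-identityˡ (indicator b))
  indicator-∧ false b = ≡.refl

  ∣p∩q∣≡∑indicator : ∀ {n} (s t : Subset n) →
                     + ∣ s ∩ t ∣ ≡ ∑[ i < n ] (indicator (lookup s i) * indicator (lookup t i))
  ∣p∩q∣≡∑indicator s t = ≡.trans (∣p∣≡∑indicator (s ∩ t))
    (sum-cong-≗ (λ i → ≡.trans (≡.cong indicator (lookup-zipWith _∧_ i s t))
                               (indicator-∧ (lookup s i) (lookup t i))))

  degree≡∑indicator : ∀ {n} (F : Family n) i → + degree F i ≡ ∑[ j < n ] indicator (lookup (F j) i)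
  degree≡∑indicator F i = ≡.trans (∣p∣≡∑indicator (tabulate (λ j → lookup (F j) i)))
    (sum-cong-≗ (λ j → ≡.cong indicator (lookup∘tabulate (λ j → lookup (F j) i) j)))

  ∑-const : ∀ n c → ∑[ i < n ] c ≡ + n * c
  ∑-const zero    c = ≡.sym (ℤ.*-zeroˡ c)
  ∑-const (suc n) c = ≡.trans (≡.cong (λ m → c + m) (∑-const n c)) (≡.sym (ℤ.suc-* (+ n) c))

module UniformFamily {p k l n : ℕ} (p-prime : Prime p) (F : Family n)
  (n≢0 : ¬ (+ n) ≡ (+ 0) [modℤ p ]) (k≢0 : ¬ (+ k) ≡ (+ 0) [modℤ p ])
  (k-l≢0 : ¬ (+ k - + l) ≡ (+ 0) [modℤ p ])
  (size : ∀ i → (+ ∣ F i ∣) ≡ (+ k) [modℤ p ])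
  (intersection : ∀ i j → i ≢ j → (+ ∣ F i ∩ F j ∣) ≡ (+ l) [modℤ p ]) where

  open Modulo p
  open CommutativeRing ℤ/pℤ
    using (setoid; sym; trans; reflexive; +-cong; +-congʳ; *-congˡ; *-congʳ; *-assoc; *-identityʳ)
  open Sum (CommutativeRing.semiring ℤ/pℤ)
    using (sum-syntax; sum-cong-≋; ∑-comm; ∑-distrib-+; *-distribˡ-sum; *-distribʳ-sum)
  open MatrixAlgebra ℤ/pℤ
  open VectorEquality setoid using (_≋_)
  open Counting
  open SetoidReasoning setoid

  private
    K L N E : ℤ
    K = + k
    L = + l
    N = + n
    E = K - L

    cancel : ∀ c u v → ¬ c ≈ 0ℤ → c * u ≈ c * v → u ≈ v
    cancel = *-almostCancelˡ p-prime

    n≉0 : ¬ N ≈ 0ℤ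
    n≉0 = n≢0 ∘ ≈⇒≡[modℤ]

    k≉0 : ¬ K ≈ 0ℤ
    k≉0 = k≢0 ∘ ≈⇒≡[modℤ]

    k-l≉0 : ¬ E ≈ 0ℤ
    k-l≉0 = k-l≢0 ∘ ≈⇒≡[modℤ]

    𝟙 : Vector ℤ n
    𝟙 _ = 1ℤ

  A : Matrix n n
  A j i = indicator (lookup (F j) i)

  B : Matrix n n
  B i j = K * A j i - L

  d : Fin n → ℤ
  d i = ∑[ j < n ] A j i

  ∑row≈k : ∀ j → ∑[ i < n ] A j i ≈ K
  ∑row≈k j = trans (reflexive (≡.sym (∣p∣≡∑indicator (F j)))) (≡[modℤ]⇒≈ (size j))

  [A⊗B]-entry : ∀ j j′ → (A ⊗ B) j j′ ≈ K * + ∣ F j ∩ F j′ ∣ + - L * K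
  [A⊗B]-entry j j′ = begin
    ∑[ i < n ] (A j i * (K * A j′ i - L))
      ≈⟨ sum-cong-≋ (λ i → reflexive (expand (A j i) (A j′ i) K L)) ⟩
    ∑[ i < n ] (K * (A j i * A j′ i) + - L * A j i)
      ≈⟨ ∑-distrib-+ (λ i → K * (A j i * A j′ i)) (λ i → - L * A j i) ⟩
    ∑[ i < n ] (K * (A j i * A j′ i)) + ∑[ i < n ] (- L * A j i)
      ≈⟨ +-cong (sym (*-distribˡ-sum K (λ i → A j i * A j′ i))) (sym (*-distribˡ-sum (- L) (A j))) ⟩
    K * ∑[ i < n ] (A j i * A j′ i) + - L * ∑[ i < n ] A j i
      ≈⟨ +-cong (*-congˡ {K} (reflexive (≡.sym (∣p∩q∣≡∑indicator (F j) (F j′)))))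
                (*-congˡ { - L} (∑row≈k j)) ⟩
    K * + ∣ F j ∩ F j′ ∣ + - L * K
      ∎
    where
    expand : ∀ a b K L → a * (K * b - L) ≡ K * (a * b) + - L * a
    expand = solve-∀

  A⊗B-scalar : IsScalarMatrix (K * E) (A ⊗ B)
  A⊗B-scalar = record { diagonal = diagonal ; offDiagonal = offDiagonal }
    where
    diagonal : ∀ j → (A ⊗ B) j j ≈ K * E
    diagonal j = begin
      (A ⊗ B) j j                    ≈⟨ [A⊗B]-entry j j ⟩
      K * + ∣ F j ∩ F j ∣ + - L * K  ≡⟨ ≡.cong (λ s → K * + ∣ s ∣ + - L * K) (∩-idem (F j)) ⟩
      K * + ∣ F j ∣ + - L * K        ≈⟨ +-congʳ { - L * K} (*-congˡ {K} (≡[modℤ]⇒≈ (size j))) ⟩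
      K * K + - L * K                ≡⟨ factor K L ⟩
      K * E                          ∎
      where
      factor : ∀ K L → K * K + - L * K ≡ K * (K - L)
      factor = solve-∀

    offDiagonal : ∀ {j j′} → j ≢ j′ → (A ⊗ B) j j′ ≈ 0ℤ
    offDiagonal {j} {j′} j≢j′ = begin
      (A ⊗ B) j j′                    ≈⟨ [A⊗B]-entry j j′ ⟩
      K * + ∣ F j ∩ F j′ ∣ + - L * K
        ≈⟨ +-congʳ { - L * K} (*-congˡ {K} (≡[modℤ]⇒≈ (intersection j j′ j≢j′))) ⟩
      K * L + - L * K                 ≡⟨ cancellation K L ⟩
      0ℤ                              ∎
      where
      cancellation : ∀ K L → K * L + - L * K ≡ 0ℤ
      cancellation = solve-∀

  A[B𝟙]≋A[E] : A · (B · 𝟙) ≋ A · (λ _ → E)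
  A[B𝟙]≋A[E] j = begin
    (A · (B · 𝟙)) j         ≈⟨ ·-assoc A B 𝟙 j ⟩
    ((A ⊗ B) · 𝟙) j         ≈⟨ IsScalarMatrix.·-scalar A⊗B-scalar 𝟙 j ⟩
    K * E * 1ℤ              ≈⟨ *-identityʳ (K * E) ⟩
    K * E                   ≈⟨ *-congʳ {E} (∑row≈k j) ⟨
    ∑[ i < n ] A j i * E    ≈⟨ *-distribʳ-sum E (A j) ⟩
    ∑[ i < n ] (A j i * E)  ∎

  B𝟙≋E : B · 𝟙 ≋ (λ _ → E)
  B𝟙≋E = ·-injective (vectorBijection (residues {{prime⇒nonZero p-prime}}) n)
                     {A} {B} KE-cancel A⊗B-scalar A[B𝟙]≋A[E]
    where
    KE-cancel : ∀ {u v} → K * E * u ≈ K * E * v → u ≈ v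
    KE-cancel {u} {v} eq =
      cancel E u v k-l≉0 (cancel K (E * u) (E * v) k≉0
        (trans (sym (*-assoc K E u)) (trans eq (*-assoc K E v))))

  [B𝟙]-entry : ∀ i → (B · 𝟙) i ≈ K * d i + N * - L
  [B𝟙]-entry i = begin
    ∑[ j < n ] ((K * A j i - L) * 1ℤ)           ≈⟨ sum-cong-≋ (λ j → reflexive (unit K (A j i) L)) ⟩
    ∑[ j < n ] (K * A j i + - L)                ≈⟨ ∑-distrib-+ (λ j → K * A j i) (λ _ → - L) ⟩
    ∑[ j < n ] (K * A j i) + ∑[ j < n ] (- L)
      ≈⟨ +-cong (sym (*-distribˡ-sum K (λ j → A j i))) (reflexive (∑-const n (- L))) ⟩
    K * d i + N * - L                           ∎
    where
    unit : ∀ K a L → (K * a - L) * 1ℤ ≡ K * a + - L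
    unit = solve-∀

  K·d≈E+L·N : ∀ i → K * d i ≈ E + L * N
  K·d≈E+L·N i = begin
    K * d i                        ≡⟨ rearrange (K * d i) N L ⟩
    (K * d i + N * - L) + L * N    ≈⟨ +-congʳ {L * N} (trans (sym ([B𝟙]-entry i)) (B𝟙≋E i)) ⟩
    E + L * N                      ∎
    where
    rearrange : ∀ x N L → x ≡ (x + N * - L) + L * N
    rearrange = solve-∀

  K²≈E+L·N : K * K ≈ E + L * N
  K²≈E+L·N = cancel N (K * K) (E + L * N) n≉0 (begin
    N * (K * K)                        ≡⟨ ≡.sym (reorder K N) ⟩
    K * (N * K)                        ≡⟨ ≡.cong (K *_) (∑-const n K) ⟨
    K * ∑[ j < n ] K                   ≈⟨ *-congˡ {K} (sum-cong-≋ (sym ∘ ∑row≈k)) ⟩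
    K * ∑[ j < n ] ∑[ i < n ] A j i    ≈⟨ *-congˡ {K} (∑-comm A) ⟩
    K * ∑[ i < n ] d i                 ≈⟨ *-distribˡ-sum K d ⟩
    ∑[ i < n ] (K * d i)               ≈⟨ sum-cong-≋ K·d≈E+L·N ⟩
    ∑[ i < n ] (E + L * N)             ≡⟨ ∑-const n (E + L * N) ⟩
    N * (E + L * N)                    ∎)
    where
    reorder : ∀ K N → K * (N * K) ≡ N * (K * K)
    reorder = solve-∀

  degree≈k : ∀ i → + degree F i ≈ K
  degree≈k i = cancel K (+ degree F i) K k≉0 (begin
    K * + degree F i   ≡⟨ ≡.cong (K *_) (degree≡∑indicator F i) ⟩
    K * d i            ≈⟨ K·d≈E+L·N i ⟩
    E + L * N          ≈⟨ K²≈E+L·N ⟨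
    K * K              ∎)

  k[k-1]≈l[n-1] : K * (K - 1ℤ) ≈ L * (N - 1ℤ)
  k[k-1]≈l[n-1] = begin
    K * (K - 1ℤ)       ≡⟨ expand K ⟩
    K * K - K          ≈⟨ +-congʳ { - K} K²≈E+L·N ⟩
    E + L * N - K      ≡⟨ collect K L N ⟩
    L * (N - 1ℤ)       ∎
    where
    expand : ∀ K → K * (K - 1ℤ) ≡ K * K - K
    expand = solve-∀
    collect : ∀ K L N → K - L + L * N - K ≡ L * (N - 1ℤ)
    collect = solve-∀

theorem8 : (p k l n : ℕ) → Prime p → 1 ≤ n →
    ¬ ((+ n) ≡ (+ 0) [modℤ p ]) →
    ¬ ((+ k) ≡ (+ 0) [modℤ p ]) →
    ¬ ((+ k - + l) ≡ (+ 0) [modℤ p ]) →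
    (F : Family n) →
    (∀ i → (+ ∣ F i ∣) ≡ (+ k) [modℤ p ]) →
    (∀ i j → i ≢ j → (+ ∣ F i ∩ F j ∣) ≡ (+ l) [modℤ p ]) →
    ((+ k * (+ k - + 1)) ≡ (+ l * (+ n - + 1)) [modℤ p ])
    × (∀ (i : Fin n) → (+ degree F i) ≡ (+ k) [modℤ p ])
theorem8 p k l n p-prime _ n≢0 k≢0 k-l≢0 F size intersection =
  ≈⇒≡[modℤ] k[k-1]≈l[n-1] , ≈⇒≡[modℤ] ∘ degree≈k
  where
  open Modulo p using (≈⇒≡[modℤ])
  open UniformFamily {l = l} p-prime F n≢0 k≢0 k-l≢0 size intersection
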